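{- For all integers $n,k\ge0$, $p\ge1$ and every $0\le j\le p-1$, $$|\{s\in\mathcal{A}_n\cap(\mathcal{S}_1\cup\mathcal{S}_2\cup\mathcal{S}_3):\mathsf{ealm}(s)=j,\ \mathsf{rep}(s)=k,\ \mathsf{max}(s)=p\}|=|\{s\in\mathcal{A}_{n-1}:\mathsf{rep}(s)=k-1,\ \mathsf{max}(s)=p\}|.$$
   Context: An inversion sequence of length $n$ is $s=(s_1,\dots,s_n)$ with $0\le s_i<i$. $\mathsf{asc}(s)=|\{i\in[n-1]:s_i<s_{i+1}\}|$; $\mathsf{rep}(s)=n-|\{s_1,\dots,s_n\}|$; $\mathsf{max}(s)=|\{i:s_i=i-1\}|$. An ascent sequence is an inversion sequence with $s_i\le\mathsf{asc}(s_1,\dots,s_{i-1})+1$ for $2\le i\le n$; $\mathcal{A}_n$ is the set of ascent sequences of length $n$. For $s\in\mathcal{A}_n$ with $p=\mathsf{max}(s)<n$, $\mathsf{ealm}(s)=s_{p+1}$. With $p=\mathsf{max}(s)$: $\mathcal{S}_1$ is the set of ascent sequences with $|s|=p+1$; $\mathcal{S}_2$ those with $|s|\ge p+2$ and $s_{p+1}\ge s_{p+2}$; $\mathcal{S}_3$ those with $|s|\ge p+2$, $s_{p+1}<s_{p+2}$, and $p\notin\{s_i:p+2\le i\le|s|\}$. -}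

module Defs where

open import Data.Nat using (ℕ; zero; suc; _+_; _∸_; _≤_; _<_; _≥_; _≤?_; _<?_)
open import Data.Nat.Properties using (_≟_)
open import Data.List using (List; []; _∷_; _++_; [_]; length; map; concatMap; upTo; filter; drop; take; deduplicate)
open import Data.List.Relation.Unary.All using (All; all?)
open import Data.List.Relation.Unary.Any using (any?)
open import Data.List.Membership.Propositional using (_∈_; _∉_)
open import Data.List.Membership.DecPropositional _≟_ using (_∈?_)
open import Data.Maybe using (Maybe; just; nothing)
open import Data.Product using (_×_; _,_)
open import Data.Sum using (_⊎_)
open import Relation.Nullary using (Dec; ¬_; _×-dec_; _⊎-dec_; ¬?)
open import Relation.Binary.PropositionalEquality using (_≡_)

-- Sequences are lists of naturals; position i (1-indexed in the paper)
-- is index i-1 here.  lookupD s i = s_{i+1} (0 if out of range; only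
-- ever used in range).
lookupD : List ℕ → ℕ → ℕ
lookupD []       _       = 0
lookupD (x ∷ _)  zero    = x
lookupD (_ ∷ xs) (suc i) = lookupD xs i

at : List ℕ → ℕ → Maybe ℕ
at []       _       = nothing
at (x ∷ _)  zero    = just x
at (_ ∷ xs) (suc i) = at xs i

invSeqs : ℕ → List (List ℕ)
invSeqs zero    = [] ∷ []
invSeqs (suc n) = concatMap (λ s → map (λ x → s ++ [ x ]) (upTo (suc n))) (invSeqs n)

asc : List ℕ → ℕ
asc s = length (filter (λ i → lookupD s i <? lookupD s (suc i)) (upTo (length s ∸ 1)))

rep : List ℕ → ℕ
rep s = length s ∸ length (deduplicate _≟_ s)

-- max(s) = #{ i : s_i = i - 1 }   (0-based: s[i] = i)
maxS : List ℕ → ℕ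
maxS s = length (filter (λ i → lookupD s i ≟ i) (upTo (length s)))

AscCond : List ℕ → Set
AscCond s = All (λ i → lookupD s i ≤ suc (asc (take i s))) (drop 1 (upTo (length s)))

ascCond? : (s : List ℕ) → Dec (AscCond s)
ascCond? s = all? (λ i → lookupD s i ≤? suc (asc (take i s))) (drop 1 (upTo (length s)))

𝒜 : ℕ → List (List ℕ)
𝒜 n = filter ascCond? (invSeqs n)

-- 𝒜_{n-1}, with the convention 𝒜_{-1} = ∅
𝒜pred : ℕ → List (List ℕ)
𝒜pred zero    = []
𝒜pred (suc m) = 𝒜 m

-- ealm(s) = s_{p+1} where p = max(s); nothing when p = |s| (undefined)
ealm : List ℕ → Maybe ℕ
ealm s = at s (maxS s)

S₁ : List ℕ → Set
S₁ s = length s ≡ suc (maxS s)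

S₂ : List ℕ → Set
S₂ s = (length s ≥ 2 + maxS s) × (lookupD s (maxS s) ≥ lookupD s (suc (maxS s)))

S₃ : List ℕ → Set
S₃ s = (length s ≥ 2 + maxS s) × (lookupD s (maxS s) < lookupD s (suc (maxS s)))
       × (maxS s ∉ drop (suc (maxS s)) s)

S₁? : (s : List ℕ) → Dec (S₁ s)
S₁? s = length s ≟ suc (maxS s)

S₂? : (s : List ℕ) → Dec (S₂ s)
S₂? s = (2 + maxS s ≤? length s) ×-dec (lookupD s (suc (maxS s)) ≤? lookupD s (maxS s))

S₃? : (s : List ℕ) → Dec (S₃ s)
S₃? s = (2 + maxS s ≤? length s) ×-dec ((lookupD s (maxS s) <? lookupD s (suc (maxS s)))
        ×-dec ¬? (maxS s ∈? drop (suc (maxS s)) s))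

LHSPred : ℕ → ℕ → ℕ → List ℕ → Set
LHSPred j k p s = (S₁ s ⊎ S₂ s ⊎ S₃ s) × (ealm s ≡ just j) × (rep s ≡ k) × (maxS s ≡ p)

LHSPred? : ∀ j k p → (s : List ℕ) → Dec (LHSPred j k p s)
LHSPred? j k p s = (S₁? s ⊎-dec S₂? s ⊎-dec S₃? s)
  ×-dec (Data.Maybe.Properties.≡-dec _≟_ (ealm s) (just j))
  ×-dec (rep s ≟ k) ×-dec (maxS s ≟ p)
  where import Data.Maybe.Properties

-- right-hand side predicate: rep(s) = k - 1 (as rep(s) + 1 = k, so empty when k = 0), max(s) = p
RHSPred : ℕ → ℕ → List ℕ → Set
RHSPred k p s = (suc (rep s) ≡ k) × (maxS s ≡ p)

RHSPred? : ∀ k p → (s : List ℕ) → Dec (RHSPred k p s)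
RHSPred? k p s = (suc (rep s) ≟ k) ×-dec (maxS s ≟ p)

-- An ascent sequence s with max(s) = p begins with the staircase 0, 1, …, p − 1, followed
-- by an entry below p.  So s on the left is 0 ⋯ (p−1) j ρ, and deleting j gives an ascent
-- sequence of length n − 1 with the same max and one repetition fewer, as j already occurs
-- in the staircase.  If ρ₁ ≤ j nothing else changes.  If j < ρ₁, the deletion loses the
-- ascent j < ρ₁, so every later entry above p is lowered by one; S₃ says that p itself
-- does not occur there, which makes this invertible by raising the entries ≥ p.  Conversely,
-- inserting j after the staircase of t (and raising when j < the next entry) lands in S₁,
-- S₂ or S₃ according as the rest of t is empty, starts at most at j, or starts above j.

module Submission where

open import Defs
open import Data.Bool using (Bool; true; false)
open import Data.Nat using (ℕ; zero; suc; pred; _+_; _∸_; _≤_; _<_; _≥_; _≤?_; _<?_; z≤n; s≤s)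
open import Data.Nat.Properties
open import Data.List
  using (List; []; _∷_; _++_; _∷ʳ_; length; map; concatMap; upTo; applyUpTo; filter; take; drop;
         deduplicate; initLast; _∷ʳ′_)
open import Data.List.Properties
  using (length-++; length-map; length-deduplicate; map-++; map-∘; map-id; map-cong; map-id-local; ∷ʳ-injective)
open import Data.List.Relation.Unary.All as All using ([]; _∷_)
open import Data.List.Relation.Unary.All.Properties using (applyUpTo⁺₁; applyUpTo⁻)
open import Data.List.Relation.Unary.Any using (here; there)
open import Data.List.Relation.Unary.AllPairs using ([]; _∷_)
open import Data.List.Relation.Unary.Unique.Propositional using (Unique)
import Data.List.Relation.Unary.Unique.Propositional.Properties as Unique
open import Data.List.Relation.Unary.Unique.DecPropositional.Properties _≟_ using (deduplicate-!)
open import Data.List.Relation.Binary.Subset.Propositional using (_⊆_)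
open import Data.List.Membership.Propositional using (_∈_; _∉_; find; lose)
open import Data.List.Membership.Propositional.Properties
open import Data.Maybe.Properties using (just-injective)
open import Data.Product using (_×_; _,_; ∃; proj₁; proj₂)
open import Data.Sum using (_⊎_; inj₁; inj₂)
open import Data.Empty using (⊥-elim)
open import Data.Unit using (⊤; tt)
open import Relation.Nullary using (yes; no; does; ¬_)
open import Relation.Nullary.Decidable using (dec-true; dec-false; does-⇔)
open import Relation.Binary.Definitions using (tri<; tri≈; tri>)
open import Function.Bundles using (mk⇔)
open import Relation.Unary using (Pred; Decidable)
open import Level using (0ℓ)
open import Relation.Binary.PropositionalEquality hiding ([_])
open import Function using (_∘_; id)

fromBool : Bool → ℕ
fromBool false = 0
fromBool true  = 1

fromBool≤1 : ∀ b → fromBool b ≤ 1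
fromBool≤1 false = z≤n
fromBool≤1 true  = s≤s z≤n

length-filter-∷ : ∀ {a p} {A : Set a} {P : Pred A p} (P? : Decidable P) x xs →
  length (filter P? (x ∷ xs)) ≡ fromBool (does (P? x)) + length (filter P? xs)
length-filter-∷ P? x xs with does (P? x)
... | true  = refl
... | false = refl

length-filter-applyUpTo-cong :
  ∀ {p q} {P : Pred ℕ p} {Q : Pred ℕ q} (P? : Decidable P) (Q? : Decidable Q) (f g : ℕ → ℕ) n →
  (∀ i → does (P? (f i)) ≡ does (Q? (g i))) →
  length (filter P? (applyUpTo f n)) ≡ length (filter Q? (applyUpTo g n))
length-filter-applyUpTo-cong P? Q? f g zero    _  = refl
length-filter-applyUpTo-cong P? Q? f g (suc n) eq
  with does (P? (f 0)) | does (Q? (g 0)) | eq 0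
... | true  | true  | _ = cong suc (length-filter-applyUpTo-cong P? Q? (f ∘ suc) (g ∘ suc) n (eq ∘ suc))
... | false | false | _ = length-filter-applyUpTo-cong P? Q? (f ∘ suc) (g ∘ suc) n (eq ∘ suc)

length-∷ʳ : ∀ {A : Set} (xs : List A) x → length (xs ∷ʳ x) ≡ suc (length xs)
length-∷ʳ xs x = trans (length-++ xs) (+-comm (length xs) 1)

length-++-∷ : ∀ {A : Set} (us : List A) x vs → length (us ++ x ∷ vs) ≡ suc (length (us ++ vs))
length-++-∷ us x vs = trans (length-++ us) (trans (+-suc _ _) (cong suc (sym (length-++ us))))

concatMap⁺ : ∀ {A B : Set} (f : A → List B) {xs} → Unique xs → (∀ a → Unique (f a)) →
  (∀ {a a′ b} → b ∈ f a → b ∈ f a′ → a ≡ a′) → Unique (concatMap f xs)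
concatMap⁺ f {[]}     _          _        _        = []
concatMap⁺ f {x ∷ xs} (x∉ ∷ xs!) f-unique disjoint =
  Unique.++⁺ (f-unique x) (concatMap⁺ f xs! f-unique disjoint) λ (b∈fx , b∈rest) →
    let a′ , a′∈ , b∈fa′ = find (∈-concatMap⁻ f {xs = xs} b∈rest)
    in All.lookup x∉ a′∈ (disjoint b∈fx b∈fa′)

Unique-⊆⇒length≤ : ∀ {A : Set} {xs ys : List A} → Unique xs → xs ⊆ ys → length xs ≤ length ys
Unique-⊆⇒length≤ {xs = []}     _          _  = z≤n
Unique-⊆⇒length≤ {xs = x ∷ xs} (x∉ ∷ xs!) xs⊆
  with us , vs , refl ← ∈-∃++ (xs⊆ (here refl)) = begin
    suc (length xs)          ≤⟨ s≤s (Unique-⊆⇒length≤ xs! xs⊆us++vs) ⟩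
    suc (length (us ++ vs))  ≡⟨ length-++-∷ us x vs ⟨
    length (us ++ x ∷ vs)    ∎
  where
  open ≤-Reasoning
  xs⊆us++vs : xs ⊆ us ++ vs
  xs⊆us++vs z∈ with ∈-++⁻ us (xs⊆ (there z∈))
  ... | inj₁ z∈us         = ∈-++⁺ˡ z∈us
  ... | inj₂ (here refl)  = ⊥-elim (All.lookup x∉ z∈ refl)
  ... | inj₂ (there z∈vs) = ∈-++⁺ʳ us z∈vs

Unique-⊆-⊇⇒length≡ : ∀ {A : Set} {xs ys : List A} →
  Unique xs → Unique ys → xs ⊆ ys → ys ⊆ xs → length xs ≡ length ys
Unique-⊆-⊇⇒length≡ xs! ys! xs⊆ys ys⊆xs =
  ≤-antisym (Unique-⊆⇒length≤ xs! xs⊆ys) (Unique-⊆⇒length≤ ys! ys⊆xs)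

length-≤-of-section : ∀ {A B : Set} {xs : List A} {ys : List B} (f : A → B) (g : B → A) →
  Unique ys → (∀ {y} → y ∈ ys → g y ∈ xs × f (g y) ≡ y) → length ys ≤ length xs
length-≤-of-section {xs = xs} {ys} f g ys! section =
  subst (length ys ≤_) (length-map f xs) (Unique-⊆⇒length≤ ys! λ y∈ →
    let g∈ , fg≡ = section y∈ in subst (_∈ map f xs) fg≡ (∈-map⁺ f g∈))

length-≡-of-inverses : ∀ {A B : Set} {xs : List A} {ys : List B} (f : A → B) (g : B → A) →
  Unique xs → Unique ys →
  (∀ {x} → x ∈ xs → f x ∈ ys × g (f x) ≡ x) →
  (∀ {y} → y ∈ ys → g y ∈ xs × f (g y) ≡ y) →
  length xs ≡ length ys
length-≡-of-inverses f g xs! ys! f-into g-into =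
  ≤-antisym (length-≤-of-section g f xs! f-into) (length-≤-of-section f g ys! g-into)

length-filter-≡-of-inverses : ∀ {A : Set} {P Q : Pred A 0ℓ} (P? : Decidable P) (Q? : Decidable Q)
  {xs ys : List A} (f g : A → A) → Unique xs → Unique ys →
  (∀ {x} → x ∈ xs → P x → (f x ∈ ys × Q (f x)) × g (f x) ≡ x) →
  (∀ {y} → y ∈ ys → Q y → (g y ∈ xs × P (g y)) × f (g y) ≡ y) →
  length (filter P? xs) ≡ length (filter Q? ys)
length-filter-≡-of-inverses P? Q? f g xs! ys! f-sound g-sound =
  length-≡-of-inverses f g (Unique.filter⁺ P? xs!) (Unique.filter⁺ Q? ys!)
    (λ x∈ → let x∈xs , Px = ∈-filter⁻ P? x∈; (fx∈ , Qfx) , gf≡ = f-sound x∈xs Px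
            in ∈-filter⁺ Q? fx∈ Qfx , gf≡)
    (λ y∈ → let y∈ys , Qy = ∈-filter⁻ Q? y∈; (gy∈ , Pgy) , fg≡ = g-sound y∈ys Qy
            in ∈-filter⁺ P? gy∈ Pgy , fg≡)

distinct : List ℕ → ℕ
distinct xs = length (deduplicate _≟_ xs)

distinct-cong : ∀ {xs ys} → xs ⊆ ys → ys ⊆ xs → distinct xs ≡ distinct ys
distinct-cong {xs} {ys} xs⊆ys ys⊆xs = Unique-⊆-⊇⇒length≡ (deduplicate-! xs) (deduplicate-! ys)
  (∈-deduplicate⁺ _≟_ ∘ xs⊆ys ∘ ∈-deduplicate⁻ _≟_ xs)
  (∈-deduplicate⁺ _≟_ ∘ ys⊆xs ∘ ∈-deduplicate⁻ _≟_ ys)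

distinct-map : ∀ {f : ℕ → ℕ} xs → (∀ {x y} → f x ≡ f y → x ≡ y) →
  distinct (map f xs) ≡ distinct xs
distinct-map {f} xs f-inj = trans
  (Unique-⊆-⊇⇒length≡ (deduplicate-! (map f xs)) (Unique.map⁺ f-inj (deduplicate-! xs))
     dedup-map⊆ map-dedup⊆)
  (length-map f (deduplicate _≟_ xs))
  where
  dedup-map⊆ : deduplicate _≟_ (map f xs) ⊆ map f (deduplicate _≟_ xs)
  dedup-map⊆ z∈ with x , x∈ , refl ← ∈-map⁻ f (∈-deduplicate⁻ _≟_ (map f xs) z∈) =
    ∈-map⁺ f (∈-deduplicate⁺ _≟_ x∈)
  map-dedup⊆ : map f (deduplicate _≟_ xs) ⊆ deduplicate _≟_ (map f xs)
  map-dedup⊆ z∈ with x , x∈ , refl ← ∈-map⁻ f z∈ =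
    ∈-deduplicate⁺ _≟_ (∈-map⁺ f (∈-deduplicate⁻ _≟_ xs x∈))

rep-insert : ∀ xs x ys → x ∈ xs → rep (xs ++ x ∷ ys) ≡ suc (rep (xs ++ ys))
rep-insert xs x ys x∈ = begin
  length (xs ++ x ∷ ys) ∸ distinct (xs ++ x ∷ ys)
    ≡⟨ cong₂ _∸_ (length-++-∷ xs x ys) (distinct-cong ⊆₁ ⊆₂) ⟩
  suc (length (xs ++ ys)) ∸ distinct (xs ++ ys)
    ≡⟨ +-∸-assoc 1 (length-deduplicate _≟_ (xs ++ ys)) ⟩
  suc (rep (xs ++ ys)) ∎
  where
  open ≡-Reasoning
  ⊆₁ : xs ++ x ∷ ys ⊆ xs ++ ys
  ⊆₁ z∈ with ∈-++⁻ xs z∈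
  ... | inj₁ z∈xs         = ∈-++⁺ˡ z∈xs
  ... | inj₂ (here refl)  = ∈-++⁺ˡ x∈
  ... | inj₂ (there z∈ys) = ∈-++⁺ʳ xs z∈ys
  ⊆₂ : xs ++ ys ⊆ xs ++ x ∷ ys
  ⊆₂ z∈ with ∈-++⁻ xs z∈
  ... | inj₁ z∈xs = ∈-++⁺ˡ z∈xs
  ... | inj₂ z∈ys = ∈-++⁺ʳ xs (there z∈ys)

rep-map : ∀ {f : ℕ → ℕ} xs → (∀ {x y} → f x ≡ f y → x ≡ y) → rep (map f xs) ≡ rep xs
rep-map {f} xs f-inj = cong₂ _∸_ (length-map f xs) (distinct-map xs f-inj)

asc-∷-∷ : ∀ x y r → asc (x ∷ y ∷ r) ≡ fromBool (does (x <? y)) + asc (y ∷ r)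
asc-∷-∷ x y r =
  trans (length-filter-∷ (λ i → lookupD (x ∷ y ∷ r) i <? lookupD (x ∷ y ∷ r) (suc i)) 0 _)
  (cong (fromBool (does (x <? y)) +_) (length-filter-applyUpTo-cong _ _ suc id (length r) (λ _ → refl)))

fixedFrom : ℕ → List ℕ → ℕ
fixedFrom k []       = 0
fixedFrom k (x ∷ xs) = fromBool (does (x ≟ k)) + fixedFrom (suc k) xs

length-filter-fixed : ∀ k s →
  length (filter (λ i → lookupD s i ≟ i + k) (upTo (length s))) ≡ fixedFrom k s
length-filter-fixed k []       = refl
length-filter-fixed k (x ∷ xs) = begin
  length (filter (λ i → lookupD (x ∷ xs) i ≟ i + k) (upTo (suc (length xs))))
    ≡⟨ length-filter-∷ (λ i → lookupD (x ∷ xs) i ≟ i + k) 0 _ ⟩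
  fromBool (does (x ≟ k)) + length (filter (λ i → lookupD (x ∷ xs) i ≟ i + k) (applyUpTo suc (length xs)))
    ≡⟨ cong (fromBool (does (x ≟ k)) +_) (length-filter-applyUpTo-cong _ _ suc id (length xs)
         (λ i → cong (λ m → does (lookupD xs i ≟ m)) (sym (+-suc i k)))) ⟩
  fromBool (does (x ≟ k)) + length (filter (λ i → lookupD xs i ≟ i + suc k) (upTo (length xs)))
    ≡⟨ cong (fromBool (does (x ≟ k)) +_) (length-filter-fixed (suc k) xs) ⟩
  fixedFrom k (x ∷ xs) ∎
  where open ≡-Reasoning

maxS≡fixedFrom0 : ∀ s → maxS s ≡ fixedFrom 0 s
maxS≡fixedFrom0 s = trans
  (length-filter-applyUpTo-cong _ _ id id (length s)
     (λ i → cong (λ m → does (lookupD s i ≟ m)) (sym (+-identityʳ i))))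
  (length-filter-fixed 0 s)

-- AscentTail l a xs: xs can follow a prefix whose last entry is l and which has a ascents.
AscentTail : ℕ → ℕ → List ℕ → Set
AscentTail l a []       = ⊤
AscentTail l a (x ∷ xs) = x ≤ suc a × AscentTail x (fromBool (does (l <? x)) + a) xs

ascent-counted : ∀ {l x} a → l < x → fromBool (does (l <? x)) + a ≡ suc a
ascent-counted {l} {x} a l<x = cong (λ b → fromBool b + a) (dec-true (l <? x) l<x)

non-ascent-uncounted : ∀ {l x} a → x ≤ l → fromBool (does (l <? x)) + a ≡ a
non-ascent-uncounted {l} {x} a x≤l = cong (λ b → fromBool b + a) (dec-false (l <? x) (≤⇒≯ x≤l))

BoundedByAscents : ℕ → ℕ → List ℕ → Set
BoundedByAscents l a xs = ∀ {i} → i < length xs → lookupD xs i ≤ suc (a + asc (l ∷ take i xs))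

asc-step : ∀ l x a xs i →
  fromBool (does (l <? x)) + a + asc (x ∷ take i xs) ≡ a + asc (l ∷ x ∷ take i xs)
asc-step l x a xs i = begin
  b + a + asc (x ∷ take i xs)    ≡⟨ cong (_+ asc (x ∷ take i xs)) (+-comm b a) ⟩
  a + b + asc (x ∷ take i xs)    ≡⟨ +-assoc a b _ ⟩
  a + (b + asc (x ∷ take i xs))  ≡⟨ cong (a +_) (sym (asc-∷-∷ l x (take i xs))) ⟩
  a + asc (l ∷ x ∷ take i xs)    ∎
  where open ≡-Reasoning
        b = fromBool (does (l <? x))

AscentTail⇒BoundedByAscents : ∀ l a xs → AscentTail l a xs → BoundedByAscents l a xs
AscentTail⇒BoundedByAscents l a (x ∷ xs) (x≤ , tail) {zero} _ =
  subst (λ m → x ≤ suc m) (sym (+-identityʳ a)) x≤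
AscentTail⇒BoundedByAscents l a (x ∷ xs) (x≤ , tail) {suc i} (s≤s i<) =
  subst (λ m → lookupD xs i ≤ suc m) (asc-step l x a xs i)
    (AscentTail⇒BoundedByAscents x _ xs tail i<)

BoundedByAscents⇒AscentTail : ∀ l a xs → BoundedByAscents l a xs → AscentTail l a xs
BoundedByAscents⇒AscentTail l a []       _     = tt
BoundedByAscents⇒AscentTail l a (x ∷ xs) bound =
  subst (λ m → x ≤ suc m) (+-identityʳ a) (bound {0} (s≤s z≤n)) ,
  BoundedByAscents⇒AscentTail x _ xs (λ {i} i< →
    subst (λ m → lookupD xs i ≤ suc m) (sym (asc-step l x a xs i)) (bound (s≤s i<)))

AscCond⇒AscentTail : ∀ x xs → AscCond (x ∷ xs) → AscentTail x 0 xs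
AscCond⇒AscentTail x xs cond =
  BoundedByAscents⇒AscentTail x 0 xs (applyUpTo⁻ suc (length xs) cond)

AscentTail⇒AscCond : ∀ x xs → AscentTail x 0 xs → AscCond (x ∷ xs)
AscentTail⇒AscCond x xs tail =
  applyUpTo⁺₁ suc (length xs) (AscentTail⇒BoundedByAscents x 0 xs tail)

InvFrom : ℕ → List ℕ → Set
InvFrom k []       = ⊤
InvFrom k (x ∷ xs) = x ≤ k × InvFrom (suc k) xs

InvFrom-mono : ∀ {k k′} xs → k ≤ k′ → InvFrom k xs → InvFrom k′ xs
InvFrom-mono []       _    _         = tt
InvFrom-mono (x ∷ xs) k≤k′ (x≤ , inv) = ≤-trans x≤ k≤k′ , InvFrom-mono xs (s≤s k≤k′) inv

InvFrom-∷ʳ⁻ : ∀ k xs y → InvFrom k (xs ∷ʳ y) → InvFrom k xs × y ≤ length xs + k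
InvFrom-∷ʳ⁻ k []       y (y≤ , _)   = tt , y≤
InvFrom-∷ʳ⁻ k (x ∷ xs) y (x≤ , inv) =
  let inv′ , y≤ = InvFrom-∷ʳ⁻ (suc k) xs y inv
  in (x≤ , inv′) , subst (y ≤_) (+-suc (length xs) k) y≤

InvFrom-∷ʳ⁺ : ∀ k xs y → InvFrom k xs → y ≤ length xs + k → InvFrom k (xs ∷ʳ y)
InvFrom-∷ʳ⁺ k []       y _          y≤ = y≤ , tt
InvFrom-∷ʳ⁺ k (x ∷ xs) y (x≤ , inv) y≤ =
  x≤ , InvFrom-∷ʳ⁺ (suc k) xs y inv (subst (y ≤_) (sym (+-suc (length xs) k)) y≤)

AscentTail⇒InvFrom : ∀ l a xs → AscentTail l a xs → InvFrom (suc a) xs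
AscentTail⇒InvFrom l a []       _          = tt
AscentTail⇒InvFrom l a (x ∷ xs) (x≤ , tail) =
  x≤ , InvFrom-mono xs (s≤s (+-monoˡ-≤ a (fromBool≤1 (does (l <? x))))) (AscentTail⇒InvFrom x _ xs tail)

extensions : ℕ → List ℕ → List (List ℕ)
extensions n s = map (s ∷ʳ_) (upTo (suc n))

∈-invSeqs⁻ : ∀ n {s} → s ∈ invSeqs n → length s ≡ n × InvFrom 0 s
∈-invSeqs⁻ zero    (here refl) = refl , tt
∈-invSeqs⁻ (suc n) s∈
  with s′ , s′∈ , ext∈ ← find (∈-concatMap⁻ (extensions n) {xs = invSeqs n} s∈)
  with x , x∈ , refl ← ∈-map⁻ (s′ ∷ʳ_) ext∈
  with len , inv ← ∈-invSeqs⁻ n s′∈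
  = trans (length-∷ʳ s′ x) (cong suc len) ,
    InvFrom-∷ʳ⁺ 0 s′ x inv (subst (x ≤_) (sym (trans (+-identityʳ _) len)) (≤-pred (∈-upTo⁻ x∈)))

∈-invSeqs⁺ : ∀ n s → length s ≡ n → InvFrom 0 s → s ∈ invSeqs n
∈-invSeqs⁺ n s len inv with initLast s
∈-invSeqs⁺ zero    .[]         _   _   | []        = here refl
∈-invSeqs⁺ zero    .(s′ ∷ʳ x)  len _   | s′ ∷ʳ′ x
  with () ← trans (sym (length-∷ʳ s′ x)) len
∈-invSeqs⁺ (suc n) .(s′ ∷ʳ x)  len inv | s′ ∷ʳ′ x =
  ∈-concatMap⁺ (extensions n) {xs = invSeqs n}
    (lose (∈-invSeqs⁺ n s′ len′ inv′) (∈-map⁺ (s′ ∷ʳ_) (∈-upTo⁺ (s≤s x≤))))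
  where
  len′ = suc-injective (trans (sym (length-∷ʳ s′ x)) len)
  inv′ = proj₁ (InvFrom-∷ʳ⁻ 0 s′ x inv)
  x≤ = subst (x ≤_) (trans (+-identityʳ _) len′) (proj₂ (InvFrom-∷ʳ⁻ 0 s′ x inv))

invSeqs-unique : ∀ n → Unique (invSeqs n)
invSeqs-unique zero    = [] ∷ []
invSeqs-unique (suc n) = concatMap⁺ (extensions n) (invSeqs-unique n)
  (λ s → Unique.map⁺ (λ {x} {y} → proj₂ ∘ ∷ʳ-injective s s) (Unique.upTo⁺ (suc n)))
  (λ {s} {s′} b∈ b∈′ →
    let x , _ , b≡ = ∈-map⁻ (s ∷ʳ_) b∈
        y , _ , b≡′ = ∈-map⁻ (s′ ∷ʳ_) b∈′
    in proj₁ (∷ʳ-injective s s′ (trans (sym b≡) b≡′)))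

𝒜-unique : ∀ n → Unique (𝒜 n)
𝒜-unique n = Unique.filter⁺ ascCond? (invSeqs-unique n)

iota : ℕ → ℕ → List ℕ
iota k zero    = []
iota k (suc q) = k ∷ iota (suc k) q

length-iota-++ : ∀ k q r → length (iota k q ++ r) ≡ length r + q
length-iota-++ k zero    r = sym (+-identityʳ (length r))
length-iota-++ k (suc q) r = trans (cong suc (length-iota-++ (suc k) q r)) (sym (+-suc (length r) q))

drop-iota-++ : ∀ k q r i → drop (i + q) (iota k q ++ r) ≡ drop i r
drop-iota-++ k zero    r i = cong (λ n → drop n r) (+-identityʳ i)
drop-iota-++ k (suc q) r i rewrite +-suc i q = drop-iota-++ (suc k) q r i

lookupD-iota-++ : ∀ k q r i → lookupD (iota k q ++ r) (i + q) ≡ lookupD r i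
lookupD-iota-++ k zero    r i = cong (lookupD r) (+-identityʳ i)
lookupD-iota-++ k (suc q) r i rewrite +-suc i q = lookupD-iota-++ (suc k) q r i

at-iota-++ : ∀ k q r → at (iota k q ++ r) q ≡ at r 0
at-iota-++ k zero    r = refl
at-iota-++ k (suc q) r = at-iota-++ (suc k) q r

∈-iota⁻ : ∀ {k q z} → z ∈ iota k q → z < k + q
∈-iota⁻ {k} {suc q} (here refl) = subst (k <_) (sym (+-suc k q)) (s≤s (m≤m+n k q))
∈-iota⁻ {k} {suc q} {z} (there z∈) = subst (z <_) (sym (+-suc k q)) (∈-iota⁻ z∈)

∈-iota⁺ : ∀ {k q z} → k ≤ z → z < k + q → z ∈ iota k q
∈-iota⁺ {k} {zero}  k≤z z< = ⊥-elim (<⇒≱ z< (subst (_≤ _) (sym (+-identityʳ k)) k≤z))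
∈-iota⁺ {k} {suc q} {z} k≤z z< with k ≟ z
... | yes refl = here refl
... | no  k≢z  = there (∈-iota⁺ (≤∧≢⇒< k≤z k≢z) (subst (z <_) (+-suc k q) z<))

staircase : ℕ → List ℕ
staircase p = iota 0 (suc p)

-- The continuations of the staircase 0 ∷ 1 ∷ ⋯ ∷ p (which has p ascents) that do not extend it.
StaircaseTail : ℕ → List ℕ → Set
StaircaseTail p []      = ⊤
StaircaseTail p (x ∷ r) = x ≤ p × AscentTail x p r

staircase-split : ∀ m xs → AscentTail m m xs →
  ∃ λ q → ∃ λ r → xs ≡ iota (suc m) q ++ r × StaircaseTail (m + q) r
staircase-split m []       _             = 0 , [] , refl , tt
staircase-split m (x ∷ xs) (x≤ , tail) with x ≟ suc m
... | yes refl =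
  let q , r , xs≡ , rest = staircase-split (suc m) xs
                             (subst (λ a → AscentTail (suc m) a xs) (ascent-counted {m} m ≤-refl) tail)
  in suc q , r , cong (suc m ∷_) xs≡ , subst (λ c → StaircaseTail c r) (sym (+-suc m q)) rest
... | no x≢ =
  let x≤m = ≤-pred (≤∧≢⇒< x≤ x≢)
  in 0 , x ∷ xs , refl , subst (λ c → StaircaseTail c (x ∷ xs)) (sym (+-identityʳ m))
       (x≤m , subst (λ a → AscentTail x a xs) (non-ascent-uncounted m x≤m) tail)

staircase-join : ∀ m q r → StaircaseTail (m + q) r → AscentTail m m (iota (suc m) q ++ r)
staircase-join m zero    []      _ = tt
staircase-join m zero    (x ∷ r) rest
  with x≤m , tail ← subst (λ c → StaircaseTail c (x ∷ r)) (+-identityʳ m) rest =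
  m≤n⇒m≤1+n x≤m , subst (λ a → AscentTail x a r) (sym (non-ascent-uncounted m x≤m)) tail
staircase-join m (suc q) r rest =
  ≤-refl ,
  subst (λ a → AscentTail (suc m) a (iota (suc (suc m)) q ++ r)) (sym (ascent-counted {m} m ≤-refl))
    (staircase-join (suc m) q r (subst (λ c → StaircaseTail c r) (+-suc m q) rest))

fixedFrom-iota : ∀ k q r → fixedFrom k (iota k q ++ r) ≡ q + fixedFrom (k + q) r
fixedFrom-iota k zero    r = cong (λ c → fixedFrom c r) (sym (+-identityʳ k))
fixedFrom-iota k (suc q) r =
  cong₂ (λ b n → fromBool b + n) (dec-true (k ≟ k) refl)
    (trans (fixedFrom-iota (suc k) q r) (cong (λ c → q + fixedFrom c r) (sym (+-suc k q))))

fixedFrom-AscentTail : ∀ l a xs k → AscentTail l a xs → suc a < k → fixedFrom k xs ≡ 0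
fixedFrom-AscentTail l a []       k _           _ = refl
fixedFrom-AscentTail l a (x ∷ xs) k (x≤ , tail) a<k =
  cong₂ (λ b n → fromBool b + n) (dec-false (x ≟ k) (<⇒≢ (≤-<-trans x≤ a<k)))
    (fixedFrom-AscentTail x _ xs (suc k) tail
      (s≤s (≤-<-trans (+-monoˡ-≤ a (fromBool≤1 (does (l <? x)))) a<k)))

fixedFrom-StaircaseTail : ∀ p r → StaircaseTail p r → fixedFrom (suc p) r ≡ 0
fixedFrom-StaircaseTail p []      _           = refl
fixedFrom-StaircaseTail p (x ∷ r) (x≤ , tail) =
  cong₂ (λ b n → fromBool b + n) (dec-false (x ≟ suc p) (<⇒≢ (s≤s x≤)))
    (fixedFrom-AscentTail x p r (suc (suc p)) tail ≤-refl)

maxS-staircase : ∀ p r → StaircaseTail p r → maxS (staircase p ++ r) ≡ suc p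
maxS-staircase p r rest = begin
  maxS (staircase p ++ r)                 ≡⟨ maxS≡fixedFrom0 (staircase p ++ r) ⟩
  fixedFrom 0 (staircase p ++ r)          ≡⟨ fixedFrom-iota 0 (suc p) r ⟩
  suc p + fixedFrom (suc p) r            ≡⟨ cong (suc p +_) (fixedFrom-StaircaseTail p r rest) ⟩
  suc p + 0                              ≡⟨ +-identityʳ (suc p) ⟩
  suc p                                  ∎
  where open ≡-Reasoning

∈𝒜-staircase⁻ : ∀ {n s p} → s ∈ 𝒜 n → maxS s ≡ suc p →
  ∃ λ r → s ≡ staircase p ++ r × StaircaseTail p r × length s ≡ n
∈𝒜-staircase⁻ {s = []}     _  ()
∈𝒜-staircase⁻ {n} {x ∷ xs} s∈ maxS≡
  with s∈inv , cond ← ∈-filter⁻ ascCond? {xs = invSeqs n} s∈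
  with len , (z≤n , _) ← ∈-invSeqs⁻ n s∈inv
  with q , r , refl , rest ← staircase-split 0 xs (AscCond⇒AscentTail 0 xs cond)
  with refl ← suc-injective (trans (sym maxS≡) (maxS-staircase q r rest))
  = r , refl , rest , len

∈𝒜-staircase⁺ : ∀ {n p r} → StaircaseTail p r → length (staircase p ++ r) ≡ n →
  staircase p ++ r ∈ 𝒜 n
∈𝒜-staircase⁺ {n} {p} {r} rest len =
  ∈-filter⁺ ascCond? {xs = invSeqs n}
    (∈-invSeqs⁺ n _ len (z≤n , AscentTail⇒InvFrom 0 0 _ tail))
    (AscentTail⇒AscCond 0 _ tail)
  where tail = staircase-join 0 p r rest

S₁₂₃At : ℕ → List ℕ → Set
S₁₂₃At q s = length s ≡ suc q
           ⊎ (length s ≥ 2 + q) × (lookupD s q ≥ lookupD s (suc q))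
           ⊎ (length s ≥ 2 + q) × (lookupD s q < lookupD s (suc q)) × (q ∉ drop (suc q) s)

module Shift (P : ℕ) where

  shiftUp : ℕ → ℕ
  shiftUp x with x <? P
  ... | yes _ = x
  ... | no  _ = suc x

  shiftDown : ℕ → ℕ
  shiftDown x with x ≤? P
  ... | yes _ = x
  ... | no  _ = pred x

  shiftUp-< : ∀ {x} → x < P → shiftUp x ≡ x
  shiftUp-< {x} x<P with x <? P
  ... | yes _   = refl
  ... | no  x≮P = ⊥-elim (x≮P x<P)

  shiftUp-≥ : ∀ {x} → ¬ x < P → shiftUp x ≡ suc x
  shiftUp-≥ {x} x≮P with x <? P
  ... | yes x<P = ⊥-elim (x≮P x<P)
  ... | no  _   = refl

  shiftDown-≤ : ∀ {x} → x ≤ P → shiftDown x ≡ x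
  shiftDown-≤ {x} x≤P with x ≤? P
  ... | yes _   = refl
  ... | no  x≰P = ⊥-elim (x≰P x≤P)

  shiftDown-> : ∀ {x} → ¬ x ≤ P → shiftDown x ≡ pred x
  shiftDown-> {x} x≰P with x ≤? P
  ... | yes x≤P = ⊥-elim (x≰P x≤P)
  ... | no  _   = refl

  shiftUp-<-mono : ∀ {a b} → a < b → shiftUp a < shiftUp b
  shiftUp-<-mono {a} {b} a<b with a <? P | b <? P
  ... | yes _   | yes _   = a<b
  ... | yes _   | no  _   = m<n⇒m<1+n a<b
  ... | no  a≮P | yes b<P = ⊥-elim (a≮P (<-trans a<b b<P))
  ... | no  _   | no  _   = s≤s a<b

  shiftUp-<-cancel : ∀ {a b} → shiftUp a < shiftUp b → a < b
  shiftUp-<-cancel {a} {b} <′ with a <? P | b <? P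
  ... | yes _   | yes _   = <′
  ... | yes a<P | no  b≮P = <-≤-trans a<P (≮⇒≥ b≮P)
  ... | no  a≮P | yes b<P = ⊥-elim (a≮P (<-trans (n<1+n a) (<-trans <′ b<P)))
  ... | no  _   | no  _   = ≤-pred <′

  shiftUp-injective : ∀ {a b} → shiftUp a ≡ shiftUp b → a ≡ b
  shiftUp-injective {a} {b} eq with <-cmp a b
  ... | tri< a<b _ _ = ⊥-elim (<⇒≢ (shiftUp-<-mono a<b) eq)
  ... | tri≈ _ a≡b _ = a≡b
  ... | tri> _ _ b<a = ⊥-elim (<⇒≢ (shiftUp-<-mono b<a) (sym eq))

  shiftUp≢P : ∀ x → shiftUp x ≢ P
  shiftUp≢P x eq with x <? P
  ... | yes x<P = <⇒≢ x<P eq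
  ... | no  x≮P = x≮P (subst (suc x ≤_) eq ≤-refl)

  shiftDown-shiftUp : ∀ x → shiftDown (shiftUp x) ≡ x
  shiftDown-shiftUp x with x <? P
  ... | yes x<P = shiftDown-≤ (<⇒≤ x<P)
  ... | no  x≮P = shiftDown-> x≮P

  shiftUp-shiftDown : ∀ x → x ≢ P → shiftUp (shiftDown x) ≡ x
  shiftUp-shiftDown x x≢P with x ≤? P
  ... | yes x≤P = shiftUp-< (≤∧≢⇒< x≤P x≢P)
  shiftUp-shiftDown zero    _ | no x≰P = ⊥-elim (x≰P z≤n)
  shiftUp-shiftDown (suc x) _ | no x≰P = shiftUp-≥ x≰P

  does-shiftUp-< : ∀ a b → does (shiftUp a <? shiftUp b) ≡ does (a <? b)
  does-shiftUp-< a b = does-⇔ (mk⇔ shiftUp-<-cancel shiftUp-<-mono) (shiftUp a <? shiftUp b) (a <? b)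

  does-shiftDown-< : ∀ a b → a ≢ P → b ≢ P → does (shiftDown a <? shiftDown b) ≡ does (a <? b)
  does-shiftDown-< a b a≢P b≢P = begin
    does (shiftDown a <? shiftDown b)
      ≡⟨ does-shiftUp-< (shiftDown a) (shiftDown b) ⟨
    does (shiftUp (shiftDown a) <? shiftUp (shiftDown b))
      ≡⟨ cong₂ (λ u v → does (u <? v)) (shiftUp-shiftDown a a≢P) (shiftUp-shiftDown b b≢P) ⟩
    does (a <? b) ∎
    where open ≡-Reasoning

  shiftUp≤suc : ∀ x → shiftUp x ≤ suc x
  shiftUp≤suc x with x <? P
  ... | yes _ = n≤1+n x
  ... | no  _ = ≤-refl

  shiftDown-bound : ∀ {x c} → x ≤ suc (suc c) → x ≢ P → P ≤ suc c → shiftDown x ≤ suc c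
  shiftDown-bound {x} x≤ x≢P P≤ with x ≤? P
  ... | yes x≤P = ≤-trans (n≤1+n x) (≤-trans (≤∧≢⇒< x≤P x≢P) P≤)
  shiftDown-bound {zero}  _  _ _ | no _ = z≤n
  shiftDown-bound {suc x} x≤ _ _ | no _ = ≤-pred x≤

  AscentTail-shiftUp : ∀ l c xs → AscentTail l c xs → AscentTail (shiftUp l) (suc c) (map shiftUp xs)
  AscentTail-shiftUp l c []       _           = tt
  AscentTail-shiftUp l c (x ∷ xs) (x≤ , tail) =
    ≤-trans (shiftUp≤suc x) (s≤s x≤) ,
    subst (λ a → AscentTail (shiftUp x) a (map shiftUp xs)) ascents (AscentTail-shiftUp x _ xs tail)
    where
    ascents : suc (fromBool (does (l <? x)) + c) ≡ fromBool (does (shiftUp l <? shiftUp x)) + suc c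
    ascents = trans (sym (+-suc _ c)) (cong (λ b → fromBool b + suc c) (sym (does-shiftUp-< l x)))

  AscentTail-shiftDown : ∀ l c xs → AscentTail l (suc c) xs → P ≤ suc c → l ≢ P → P ∉ xs →
    AscentTail (shiftDown l) c (map shiftDown xs)
  AscentTail-shiftDown l c []       _           _  _   _  = tt
  AscentTail-shiftDown l c (x ∷ xs) (x≤ , tail) P≤ l≢P P∉ =
    shiftDown-bound x≤ x≢P P≤ ,
    subst (λ b → AscentTail (shiftDown x) (fromBool b + c) (map shiftDown xs))
      (sym (does-shiftDown-< l x l≢P x≢P))
      (AscentTail-shiftDown x _ xs (subst (λ a → AscentTail x a xs) (+-suc _ c) tail)
         (≤-trans P≤ (s≤s (m≤n+m c _))) x≢P (P∉ ∘ there))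
    where
    x≢P : x ≢ P
    x≢P x≡P = P∉ (here (sym x≡P))

-- The paper's p is suc p here: the staircase is 0 ∷ ⋯ ∷ p and ealm(s) = j ≤ p.
module Bijection (p j : ℕ) (j≤p : j ≤ p) where
  open Shift (suc p)

  relabelWith : (ℕ → ℕ) → List ℕ → List ℕ
  relabelWith f []      = []
  relabelWith f (a ∷ r) with a ≤? j
  ... | yes _ = a ∷ r
  ... | no  _ = a ∷ map f r

  relabelWith-≤ : ∀ f {a} r → a ≤ j → relabelWith f (a ∷ r) ≡ a ∷ r
  relabelWith-≤ f {a} r a≤j with a ≤? j
  ... | yes _   = refl
  ... | no  a≰j = ⊥-elim (a≰j a≤j)

  relabelWith-> : ∀ f {a} r → ¬ a ≤ j → relabelWith f (a ∷ r) ≡ a ∷ map f r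
  relabelWith-> f {a} r a≰j with a ≤? j
  ... | yes a≤j = ⊥-elim (a≰j a≤j)
  ... | no  _   = refl

  length-relabelWith : ∀ f r → length (relabelWith f r) ≡ length r
  length-relabelWith f []      = refl
  length-relabelWith f (a ∷ r) with a ≤? j
  ... | yes _ = refl
  ... | no  _ = cong suc (length-map f r)

  relabel unrelabel : List ℕ → List ℕ
  relabel   = relabelWith shiftUp
  unrelabel = relabelWith shiftDown

  unrelabel-relabel : ∀ r → unrelabel (relabel r) ≡ r
  unrelabel-relabel []      = refl
  unrelabel-relabel (a ∷ r) with a ≤? j
  ... | yes a≤j = relabelWith-≤ shiftDown r a≤j
  ... | no  a≰j = trans (relabelWith-> shiftDown (map shiftUp r) a≰j)
    (cong (a ∷_) (trans (sym (map-∘ r)) (trans (map-cong shiftDown-shiftUp r) (map-id r))))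

  AscentTail-relabel : ∀ r → StaircaseTail p r → AscentTail j p (relabel r)
  AscentTail-relabel []      _            = tt
  AscentTail-relabel (a ∷ r) (a≤p , tail) with a ≤? j
  ... | yes a≤j = m≤n⇒m≤1+n a≤p ,
    subst (λ c → AscentTail a c r) (sym (non-ascent-uncounted p a≤j)) tail
  ... | no  a≰j = m≤n⇒m≤1+n a≤p ,
    subst (λ c → AscentTail a c (map shiftUp r)) (sym (ascent-counted p (≰⇒> a≰j)))
      (subst (λ l → AscentTail l (suc p) (map shiftUp r)) (shiftUp-< (s≤s a≤p))
        (AscentTail-shiftUp a p r tail))

  -- The S₁ ∪ S₂ ∪ S₃ condition on 0 ∷ ⋯ ∷ p ∷ j ∷ ρ.
  Admissible : List ℕ → Set
  Admissible []      = ⊤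
  Admissible (b ∷ ρ) = b ≤ j ⊎ suc p ∉ b ∷ ρ

  Admissible-relabel : ∀ r → StaircaseTail p r → Admissible (relabel r)
  Admissible-relabel []      _       = tt
  Admissible-relabel (a ∷ r) (a≤p , _) with a ≤? j
  ... | yes a≤j = inj₁ a≤j
  ... | no  _   = inj₂ λ where
    (here P≡a)  → <⇒≢ (s≤s a≤p) (sym P≡a)
    (there P∈)  → let y , _ , P≡ = ∈-map⁻ shiftUp P∈ in shiftUp≢P y (sym P≡)

  relabel-unrelabel : ∀ ρ → AscentTail j p ρ → Admissible ρ →
    StaircaseTail p (unrelabel ρ) × relabel (unrelabel ρ) ≡ ρ
  relabel-unrelabel []      _           _   = tt , refl
  relabel-unrelabel (b ∷ ρ) (b≤ , tail) adm with b ≤? j | adm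
  ... | yes b≤j | _ =
    (≤-trans b≤j j≤p , subst (λ c → AscentTail b c ρ) (non-ascent-uncounted p b≤j) tail) ,
    relabelWith-≤ shiftUp ρ b≤j
  ... | no  b≰j | inj₁ b≤j = ⊥-elim (b≰j b≤j)
  ... | no  b≰j | inj₂ P∉  =
    (b≤p , subst (λ l → AscentTail l p (map shiftDown ρ)) (shiftDown-≤ b≤)
             (AscentTail-shiftDown b p ρ tail′ ≤-refl b≢P (P∉ ∘ there))) ,
    trans (relabelWith-> shiftUp (map shiftDown ρ) b≰j)
      (cong (b ∷_) (trans (sym (map-∘ ρ)) (map-id-local (All.tabulate λ {x} x∈ →
        shiftUp-shiftDown x (λ x≡P → P∉ (there (subst (_∈ ρ) x≡P x∈)))))))
    where
    b≢P : b ≢ suc p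
    b≢P b≡P = P∉ (here (sym b≡P))
    b≤p = ≤-pred (≤∧≢⇒< b≤ b≢P)
    tail′ = subst (λ c → AscentTail b c ρ) (ascent-counted p (≰⇒> b≰j)) tail

  I : List ℕ
  I = staircase p

  long : ∀ b ρ → 2 + suc p ≤ length (I ++ j ∷ b ∷ ρ)
  long b ρ = subst (2 + suc p ≤_) (sym (length-iota-++ 0 (suc p) (j ∷ b ∷ ρ)))
    (s≤s (s≤s (m≤n+m (suc p) (length ρ))))

  lookupD-ealm : ∀ ρ → lookupD (I ++ j ∷ ρ) (suc p) ≡ j
  lookupD-ealm ρ = lookupD-iota-++ 0 (suc p) (j ∷ ρ) 0

  lookupD-after-ealm : ∀ b ρ → lookupD (I ++ j ∷ b ∷ ρ) (suc (suc p)) ≡ b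
  lookupD-after-ealm b ρ = lookupD-iota-++ 0 (suc p) (j ∷ b ∷ ρ) 1

  drop-after-ealm : ∀ ρ → drop (suc (suc p)) (I ++ j ∷ ρ) ≡ ρ
  drop-after-ealm ρ = drop-iota-++ 0 (suc p) (j ∷ ρ) 1

  Admissible⇒S₁₂₃ : ∀ ρ → Admissible ρ → S₁₂₃At (suc p) (I ++ j ∷ ρ)
  Admissible⇒S₁₂₃ []      _ = inj₁ (length-iota-++ 0 (suc p) (j ∷ []))
  Admissible⇒S₁₂₃ (b ∷ ρ) adm with b ≤? j | adm
  ... | yes b≤j | _ = inj₂ (inj₁ (long b ρ ,
    subst₂ _≤_ (sym (lookupD-after-ealm b ρ)) (sym (lookupD-ealm (b ∷ ρ))) b≤j))
  ... | no  b≰j | inj₁ b≤j = ⊥-elim (b≰j b≤j)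
  ... | no  b≰j | inj₂ P∉  = inj₂ (inj₂ (long b ρ ,
    subst₂ _<_ (sym (lookupD-ealm (b ∷ ρ))) (sym (lookupD-after-ealm b ρ)) (≰⇒> b≰j) ,
    subst (suc p ∉_) (sym (drop-after-ealm (b ∷ ρ))) P∉))

  S₁₂₃⇒Admissible : ∀ ρ → S₁₂₃At (suc p) (I ++ j ∷ ρ) → Admissible ρ
  S₁₂₃⇒Admissible []      _ = tt
  S₁₂₃⇒Admissible (b ∷ ρ) (inj₁ len≡) =
    ⊥-elim (<-irrefl refl (subst (2 + suc p ≤_) len≡ (long b ρ)))
  S₁₂₃⇒Admissible (b ∷ ρ) (inj₂ (inj₁ (_ , b≤j))) =
    inj₁ (subst₂ _≤_ (lookupD-after-ealm b ρ) (lookupD-ealm (b ∷ ρ)) b≤j)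
  S₁₂₃⇒Admissible (b ∷ ρ) (inj₂ (inj₂ (_ , _ , P∉))) =
    inj₂ (subst (suc p ∉_) (drop-after-ealm (b ∷ ρ)) P∉)

  rep-relabel : ∀ r → StaircaseTail p r → rep (I ++ relabel r) ≡ rep (I ++ r)
  rep-relabel []      _         = refl
  rep-relabel (a ∷ r) (a≤p , _) with a ≤? j
  ... | yes _ = refl
  ... | no  _ = begin
    rep (I ++ a ∷ map shiftUp r)              ≡⟨ cong rep shifted ⟨
    rep (map shiftUp (I ++ a ∷ r))            ≡⟨ rep-map (I ++ a ∷ r) shiftUp-injective ⟩
    rep (I ++ a ∷ r)                          ∎
    where
    open ≡-Reasoning
    shifted : map shiftUp (I ++ a ∷ r) ≡ I ++ a ∷ map shiftUp r
    shifted = trans (map-++ shiftUp I (a ∷ r)) (cong₂ _++_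
      (map-id-local {xs = I} (All.tabulate (shiftUp-< ∘ ∈-iota⁻ {0} {suc p})))
      (cong (_∷ map shiftUp r) (shiftUp-< (s≤s a≤p))))

  rep-insert-ealm : ∀ r → StaircaseTail p r → rep (I ++ j ∷ relabel r) ≡ suc (rep (I ++ r))
  rep-insert-ealm r rest =
    trans (rep-insert I j (relabel r) (∈-iota⁺ z≤n (s≤s j≤p))) (cong suc (rep-relabel r rest))

  length-++-relabelWith : ∀ f r → length (I ++ relabelWith f r) ≡ length (I ++ r)
  length-++-relabelWith f r =
    trans (length-++ I) (trans (cong (length I +_) (length-relabelWith f r)) (sym (length-++ I)))

  ealm-staircase : ∀ r → maxS (I ++ r) ≡ suc p → ealm (I ++ r) ≡ at r 0
  ealm-staircase r maxS≡ = trans (cong (at (I ++ r)) maxS≡) (at-iota-++ 0 (suc p) r)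

  LHSPred-staircase⁺ : ∀ {k} ρ → AscentTail j p ρ → Admissible ρ → rep (I ++ j ∷ ρ) ≡ k →
    LHSPred j k (suc p) (I ++ j ∷ ρ)
  LHSPred-staircase⁺ ρ tail adm rep≡ =
    subst (λ q → S₁₂₃At q (I ++ j ∷ ρ)) (sym maxS≡) (Admissible⇒S₁₂₃ ρ adm) ,
    ealm-staircase (j ∷ ρ) maxS≡ , rep≡ , maxS≡
    where maxS≡ = maxS-staircase p (j ∷ ρ) (j≤p , tail)

  LHSPred-staircase⁻ : ∀ {k} r → LHSPred j k (suc p) (I ++ r) →
    ∃ λ ρ → r ≡ j ∷ ρ × Admissible ρ × rep (I ++ j ∷ ρ) ≡ k
  LHSPred-staircase⁻ []      (_ , ealm≡ , _ , maxS≡)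
    with () ← trans (sym (ealm-staircase [] maxS≡)) ealm≡
  LHSPred-staircase⁻ (x ∷ ρ) (S₁₂₃ , ealm≡ , rep≡ , maxS≡)
    with refl ← just-injective (trans (sym (ealm-staircase (x ∷ ρ) maxS≡)) ealm≡) =
    ρ , refl , S₁₂₃⇒Admissible ρ (subst (λ q → S₁₂₃At q (I ++ j ∷ ρ)) maxS≡ S₁₂₃) , rep≡

  insertEalm removeEalm : List ℕ → List ℕ
  insertEalm t = I ++ j ∷ relabel (drop (suc p) t)
  removeEalm s = I ++ unrelabel (drop (suc (suc p)) s)

  insertEalm-sound : ∀ m k {t} → t ∈ 𝒜 m → RHSPred k (suc p) t →
    (insertEalm t ∈ 𝒜 (suc m) × LHSPred j k (suc p) (insertEalm t)) × removeEalm (insertEalm t) ≡ t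
  insertEalm-sound m k t∈ (rep≡ , maxS≡)
    with r , refl , rest , len ← ∈𝒜-staircase⁻ {m} t∈ maxS≡
    rewrite drop-iota-++ 0 (suc p) r 0 | drop-after-ealm (relabel r) | unrelabel-relabel r =
    (∈𝒜-staircase⁺ {suc m} (j≤p , tail) (trans (length-++-∷ I j (relabel r)) (cong suc len′)) ,
     LHSPred-staircase⁺ (relabel r) tail (Admissible-relabel r rest)
       (trans (rep-insert-ealm r rest) rep≡)) ,
    refl
    where
    tail = AscentTail-relabel r rest
    len′ = trans (length-++-relabelWith shiftUp r) len

  removeEalm-sound : ∀ m k {s} → s ∈ 𝒜 (suc m) → LHSPred j k (suc p) s →
    (removeEalm s ∈ 𝒜 m × RHSPred k (suc p) (removeEalm s)) × insertEalm (removeEalm s) ≡ s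
  removeEalm-sound m k s∈ lhs@(_ , _ , _ , maxS≡)
    with r , refl , rest₀ , len ← ∈𝒜-staircase⁻ {suc m} s∈ maxS≡
    with ρ , refl , adm , rep≡ ← LHSPred-staircase⁻ r lhs
    with rest , relabel≡ ← relabel-unrelabel ρ (proj₂ rest₀) adm
    rewrite drop-after-ealm ρ | drop-iota-++ 0 (suc p) (unrelabel ρ) 0 =
    (∈𝒜-staircase⁺ {m} rest (suc-injective (trans (sym len′) len)) ,
     trans (sym (rep-insert-ealm (unrelabel ρ) rest))
       (trans (cong (λ ρ′ → rep (I ++ j ∷ ρ′)) relabel≡) rep≡) ,
     maxS-staircase p (unrelabel ρ) rest) ,
    cong (λ ρ′ → I ++ j ∷ ρ′) relabel≡
    where
    len′ : length (I ++ j ∷ ρ) ≡ suc (length (I ++ unrelabel ρ))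
    len′ = trans (length-++-∷ I j ρ) (cong suc (sym (length-++-relabelWith shiftDown ρ)))

lemma4p5 : (n k p j : ℕ) → 1 ≤ p → j < p →
    length (filter (LHSPred? j k p) (𝒜 n)) ≡ length (filter (RHSPred? k p) (𝒜pred n))
lemma4p5 zero    k (suc p) j _ _         = refl  -- 𝒜 0 = [ [] ] and max([]) = 0
lemma4p5 (suc m) k (suc p) j _ (s≤s j≤p) =
  length-filter-≡-of-inverses (LHSPred? j k (suc p)) (RHSPred? k (suc p)) removeEalm insertEalm
    (𝒜-unique (suc m)) (𝒜-unique m) (removeEalm-sound m k) (insertEalm-sound m k)
  where open Bijection p j j≤p
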